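{- Let $i\in\mathbb N$ and, for $j\in\mathbb Z$, let $P_j=\{j,j+1,j+2,\dots\}$. Define $\mathcal C_1^i=\bigcup_{j\in\mathbb N}\{\{0,\dots,i\}\cup A\cup P_j \mid A\subseteq\mathbb Z\}$, $\mathcal C_2^i=\{A\cup\mathbb Z_{<0}\mid A\subseteq\mathbb Z\setminus\{0,\dots,i\}\}$ and $\mathcal C^i=\mathcal C_1^i\cup\mathcal C_2^i$. Then $\mathcal C^i$ cannot be generated in the limit with $i+1$ omissions.
   Context: Collections are over the universe $\mathbb Z$; a language is an infinite subset of $\mathbb Z$. A generator algorithm is an arbitrary function $G$ from finite sequences of integers to integers, with output $z_t=G(x_0,\dots,x_t)$, and $S_t=\{x_0,\dots,x_t\}$. An enumeration of $K$ with $m$ omissions is an infinite sequence $x_0,x_1,\dots$ of pairwise distinct elements with $\bigcup_k\{x_k\}\subseteq K$ and $|K\setminus\bigcup_k\{x_k\}|\le m$. $G$ generates in the limit with $m$ omissions for $\mathcal C$ if for every $K\in\mathcal C$ and every enumeration of $K$ with $m$ omissions there is $t^\star$ such that $z_t\in K\setminus S_t$ for all $t\ge t^\star$. -}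

module Defs where

open import Data.Nat using (ℕ; zero; suc) renaming (_≤_ to _≤ℕ_)
open import Data.Integer using (ℤ; +_; _≤_; _<_)
open import Data.List using (List; map; upTo; length)
open import Data.List.Membership.Propositional using (_∈_)
open import Data.Product using (Σ; _×_; ∃)
open import Data.Sum using (_⊎_)
open import Function.Bundles using (_⇔_)
open import Function.Definitions using (Injective)
open import Relation.Binary.PropositionalEquality using (_≡_)
open import Relation.Nullary using (¬_)
open import Level using (Level; 0ℓ) renaming (suc to lsuc)

Subset : Set₁
Subset = ℤ → Set

Collection : Set₂
Collection = Subset → Set₁

_≐_ : Subset → Subset → Set
K ≐ L = ∀ z → K z ⇔ L z

Interval : ℕ → Subset
Interval i z = (+ 0 ≤ z) × (z ≤ + i)

P : ℤ → Subset
P j z = j ≤ z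

Neg : Subset
Neg z = z < + 0

C₁ : ℕ → Collection
C₁ i K = Σ ℕ λ j → Σ Subset λ A →
  K ≐ (λ z → Interval i z ⊎ A z ⊎ P (+ j) z)

C₂ : ℕ → Collection
C₂ i K = Σ Subset λ A →
  (∀ z → A z → ¬ Interval i z) × (K ≐ (λ z → A z ⊎ Neg z))

C : ℕ → Collection
C i K = C₁ i K ⊎ C₂ i K

Generator : Set
Generator = List ℤ → ℤ

prefix : (ℕ → ℤ) → ℕ → List ℤ
prefix x t = map x (upTo (suc t))

InS : (ℕ → ℤ) → ℕ → ℤ → Set
InS x t z = Σ ℕ λ k → (k ≤ℕ t) × (x k ≡ z)

-- x is an enumeration of K with m omissions: pairwise distinct, every
-- element lies in K, and K ∖ range(x) has at most m elements (i.e. is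
-- covered by a list of length ≤ m).
IsEnumeration : ℕ → Subset → (ℕ → ℤ) → Set
IsEnumeration m K x =
  Injective _≡_ _≡_ x ×
  (∀ k → K (x k)) ×
  (Σ (List ℤ) λ L → (length L ≤ℕ m) ×
     (∀ z → K z → (Σ ℕ λ k → x k ≡ z) ⊎ z ∈ L))

GeneratesInLimit : ℕ → Collection → Generator → Set₁
GeneratesInLimit m 𝒞 G =
  (K : Subset) → 𝒞 K → (x : ℕ → ℤ) → IsEnumeration m K x →
  Σ ℕ λ t⋆ → ∀ t → t⋆ ≤ℕ t →
    K (G (prefix x t)) × ¬ InS x t (G (prefix x t))

-- The adversary enumerates, in alternating phases, the negatives -1, -2, … and increasing
-- naturals above i, and after each element looks at the generator's guess: a guess on the
-- side currently being enumerated ends the phase, and a guessed natural is never enumerated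
-- afterwards.  Every phase ends: were the phase at time s to last forever, the enumeration
-- would be one of a language in C i (of C₂ without omissions, resp. of C₁ omitting just
-- 0, …, i) all of whose new elements lie on the current side, so a successful generator
-- would eventually guess on that side.  Constructively, this is run against the adversary
-- that stops looking at time s, which agrees with the real one until the latter switches.
-- So there are infinitely many phases; the enumeration then lists its range together with
-- all negatives, a language of C₂, without omissions, but at the end of every naturals phase
-- the generator guesses a natural that is never enumerated.

module Submission where

open import Defs
open import Data.Bool using (Bool; true; false; if_then_else_)
open import Data.Empty using (⊥-elim)
open import Data.Integer using (ℤ; +_; -[1+_]; +≤+; +<+)
open import Data.List using (List; []; _∷_; _∷ʳ_; map; upTo; length)
open import Data.List.Membership.Propositional using (_∈_)
open import Data.List.Membership.Propositional.Properties using (∈-map⁺; ∈-upTo⁺)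
open import Data.List.Properties using (upTo-∷ʳ; map-++; length-map; length-upTo)
open import Data.Nat using (ℕ; zero; suc; _+_; _∸_; _⊔_; z≤n; s≤s; _≤?_; _<?_; _≤′_; ≤′-refl; ≤′-step)
  renaming (_≤_ to _≤ℕ_; _<_ to _<ℕ_)
import Data.Nat.Properties as ℕ
open import Data.Product using (Σ; _×_; _,_; proj₁; proj₂)
open import Data.Sum using (_⊎_; inj₁; inj₂; map₂)
open import Function using (id; _∘_)
open import Function.Bundles using (mk⇔)
open import Function.Definitions using (Injective)
open import Relation.Binary using (tri<; tri≈; tri>)
open import Relation.Binary.PropositionalEquality
  using (_≡_; _≢_; refl; sym; trans; cong; subst; module ≡-Reasoning)
open import Relation.Nullary using (¬_; Dec; yes; no; does)
open import Relation.Nullary.Decidable using (dec-true; dec-false)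

Range : (ℕ → ℤ) → Subset
Range x z = Σ ℕ λ k → x k ≡ z

monotone-by-steps : (f : ℕ → ℕ) → (∀ k → f k ≤ℕ f (suc k)) → ∀ {k l} → k ≤ℕ l → f k ≤ℕ f l
monotone-by-steps f step k≤l = go (ℕ.≤⇒≤′ k≤l)
  where
  go : ∀ {k l} → k ≤′ l → f k ≤ℕ f l
  go ≤′-refl = ℕ.≤-refl
  go (≤′-step k≤′l) = ℕ.≤-trans (go k≤′l) (step _)

fresh⇒injective : (x : ℕ → ℤ) → (∀ {k l} → k ≤ℕ l → x (suc l) ≢ x k) → Injective _≡_ _≡_ x
fresh⇒injective x fresh {k} {l} e with ℕ.<-cmp k l
... | tri≈ _ k≡l _ = k≡l
fresh⇒injective x fresh {k} {suc l} e | tri< (s≤s k≤l) _ _ = ⊥-elim (fresh k≤l (sym e))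
fresh⇒injective x fresh {suc k} {l} e | tri> _ _ (s≤s l≤k) = ⊥-elim (fresh l≤k e)

InS-mono : ∀ {x s t z} → s ≤ℕ t → InS x s z → InS x t z
InS-mono s≤t (k , k≤s , e) = k , ℕ.≤-trans k≤s s≤t , e

range∪Neg∈C : ∀ {i} {x : ℕ → ℤ} → (∀ k → ¬ Interval i (x k)) → C i (λ z → Range x z ⊎ Neg z)
range∪Neg∈C {x = x} avoids = inj₂ (Range x , (λ { _ (k , refl) → avoids k }) , λ _ → mk⇔ id id)

Interval∪range∪P∈C : ∀ {i j} {x : ℕ → ℤ} → C i (λ z → Interval i z ⊎ Range x z ⊎ P (+ j) z)
Interval∪range∪P∈C {j = j} {x} = inj₁ (j , Range x , λ _ → mk⇔ id id)

enumerates-range∪Neg : ∀ {m} {x : ℕ → ℤ} → Injective _≡_ _≡_ x → (∀ n → Range x -[1+ n ]) →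
  IsEnumeration m (λ z → Range x z ⊎ Neg z) x
enumerates-range∪Neg {x = x} injective negatives = injective , (λ k → inj₁ (k , refl)) , [] , z≤n , cover
  where
  cover : ∀ z → Range x z ⊎ Neg z → Range x z ⊎ z ∈ []
  cover z (inj₁ r) = inj₁ r
  cover -[1+ n ] (inj₂ _) = inj₁ (negatives n)
  cover (+ _) (inj₂ (+<+ ()))

enumerates-Interval∪range∪P : ∀ {i j} {x : ℕ → ℤ} → Injective _≡_ _≡_ x → (∀ n → j ≤ℕ n → Range x (+ n)) →
  IsEnumeration (suc i) (λ z → Interval i z ⊎ Range x z ⊎ P (+ j) z) x
enumerates-Interval∪range∪P {i} {j} {x} injective naturals =
  injective , (λ k → inj₂ (inj₁ (k , refl))) , L , ℕ.≤-reflexive length-L , cover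
  where
  L : List ℤ
  L = map +_ (upTo (suc i))
  length-L : length L ≡ suc i
  length-L = trans (length-map +_ (upTo (suc i))) (length-upTo (suc i))
  cover : ∀ z → Interval i z ⊎ Range x z ⊎ P (+ j) z → Range x z ⊎ z ∈ L
  cover (+ n) (inj₁ (_ , +≤+ n≤i)) = inj₂ (∈-map⁺ +_ (∈-upTo⁺ (s≤s n≤i)))
  cover -[1+ _ ] (inj₁ (() , _))
  cover z (inj₂ (inj₁ r)) = inj₁ r
  cover (+ n) (inj₂ (inj₂ (+≤+ j≤n))) = inj₁ (naturals n j≤n)
  cover -[1+ _ ] (inj₂ (inj₂ ()))

eventually-guesses-in : ∀ {m 𝒞 G K x} (Q : Subset) → GeneratesInLimit m 𝒞 G → 𝒞 K → IsEnumeration m K x →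
  ∀ s → (∀ z → K z → InS x s z ⊎ Q z) → Σ ℕ λ d → Q (G (prefix x (d + s)))
eventually-guesses-in Q generates K∈𝒞 enumeration s K⊆S∪Q with generates _ K∈𝒞 _ enumeration
... | t⋆ , success with success (t⋆ + s) (ℕ.m≤m+n t⋆ s)
...   | guess∈K , guess∉S with K⊆S∪Q _ guess∈K
...     | inj₁ guess∈S = ⊥-elim (guess∉S (InS-mono (ℕ.m≤n+m s t⋆) guess∈S))
...     | inj₂ guess∈Q = t⋆ , guess∈Q

data Phase : Set where
  negatives naturals : Phase

_≟ᴾ_ : (p q : Phase) → Dec (p ≡ q)
negatives ≟ᴾ negatives = yes refl
naturals ≟ᴾ naturals = yes refl
negatives ≟ᴾ naturals = no λ ()
naturals ≟ᴾ negatives = no λ ()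

side : ℤ → Phase
side (+ _) = naturals
side -[1+ _ ] = negatives

-- A guess on the side being emitted ends the phase; raising the natural counter past a
-- guessed natural n makes sure that n is never emitted.
react : ℤ → Phase → ℕ → Phase × ℕ
react -[1+ _ ] negatives q = naturals , q
react (+ n) naturals q = negatives , q ⊔ suc n
react _ p q = p , q

react-ignores : ∀ g p q → side g ≢ p → react g p q ≡ (p , q)
react-ignores (+ _) negatives q _ = refl
react-ignores -[1+ _ ] naturals q _ = refl
react-ignores (+ _) naturals q ≢ = ⊥-elim (≢ refl)
react-ignores -[1+ _ ] negatives q ≢ = ⊥-elim (≢ refl)

react-nextNat-mono : ∀ g p q → q ≤ℕ proj₂ (react g p q)
react-nextNat-mono (+ n) naturals q = ℕ.m≤m⊔n q (suc n)
react-nextNat-mono (+ _) negatives q = ℕ.≤-refl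
react-nextNat-mono -[1+ _ ] negatives q = ℕ.≤-refl
react-nextNat-mono -[1+ _ ] naturals q = ℕ.≤-refl

-- The next negative to emit is -[1+ nextNeg ], the next natural is + nextNat.
record State : Set where
  constructor ⟨_,_,_,_,_⟩
  field
    phase : Phase
    nextNeg nextNat : ℕ
    current : ℤ
    history : List ℤ
open State

emit : State → State
emit ⟨ negatives , a , q , _ , h ⟩ = ⟨ negatives , suc a , q , -[1+ a ] , h ∷ʳ -[1+ a ] ⟩
emit ⟨ naturals , a , q , _ , h ⟩ = ⟨ naturals , a , suc q , + q , h ∷ʳ + q ⟩

emit-phase : ∀ s → phase (emit s) ≡ phase s
emit-phase ⟨ negatives , _ , _ , _ , _ ⟩ = refl
emit-phase ⟨ naturals , _ , _ , _ , _ ⟩ = refl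

emit-history : ∀ s → history (emit s) ≡ history s ∷ʳ current (emit s)
emit-history ⟨ negatives , _ , _ , _ , _ ⟩ = refl
emit-history ⟨ naturals , _ , _ , _ , _ ⟩ = refl

side-current-emit : ∀ s → side (current (emit s)) ≡ phase (emit s)
side-current-emit ⟨ negatives , _ , _ , _ , _ ⟩ = refl
side-current-emit ⟨ naturals , _ , _ , _ , _ ⟩ = refl

emit-negative : ∀ s {m} → current (emit s) ≡ -[1+ m ] → nextNeg s ≡ m × nextNeg (emit s) ≡ suc m
emit-negative ⟨ negatives , _ , _ , _ , _ ⟩ refl = refl , refl
emit-negative ⟨ naturals , _ , _ , _ , _ ⟩ ()

emit-natural : ∀ s {p} → current (emit s) ≡ + p → nextNat s ≡ p × nextNat (emit s) ≡ suc p
emit-natural ⟨ negatives , _ , _ , _ , _ ⟩ ()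
emit-natural ⟨ naturals , _ , _ , _ , _ ⟩ refl = refl , refl

emit-in-negatives : ∀ s → phase s ≡ negatives → nextNeg (emit s) ≡ suc (nextNeg s)
emit-in-negatives ⟨ negatives , _ , _ , _ , _ ⟩ _ = refl

emit-in-naturals : ∀ s → phase s ≡ naturals →
  current (emit s) ≡ + nextNat s × nextNat (emit s) ≡ suc (nextNat s)
emit-in-naturals ⟨ naturals , _ , _ , _ , _ ⟩ _ = refl , refl

emit-nextNeg-cases : ∀ s → nextNeg (emit s) ≡ nextNeg s ⊎
  (nextNeg (emit s) ≡ suc (nextNeg s) × current (emit s) ≡ -[1+ nextNeg s ])
emit-nextNeg-cases ⟨ negatives , _ , _ , _ , _ ⟩ = inj₂ (refl , refl)
emit-nextNeg-cases ⟨ naturals , _ , _ , _ , _ ⟩ = inj₁ refl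

emit-nextNeg-mono : ∀ s → nextNeg s ≤ℕ nextNeg (emit s)
emit-nextNeg-mono ⟨ negatives , a , _ , _ , _ ⟩ = ℕ.n≤1+n a
emit-nextNeg-mono ⟨ naturals , _ , _ , _ , _ ⟩ = ℕ.≤-refl

emit-nextNat-mono : ∀ s → nextNat s ≤ℕ nextNat (emit s)
emit-nextNat-mono ⟨ negatives , _ , _ , _ , _ ⟩ = ℕ.≤-refl
emit-nextNat-mono ⟨ naturals , _ , q , _ , _ ⟩ = ℕ.n≤1+n q

module Adversary (i : ℕ) (G : Generator) where

  Switches : State → Set
  Switches s = side (G (history s)) ≡ phase s

  Switches? : ∀ s → Dec (Switches s)
  Switches? s = side (G (history s)) ≟ᴾ phase s

  listen : Bool → State → State
  listen b s = record s { phase = proj₁ reaction ; nextNat = proj₂ reaction }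
    where
    reaction : Phase × ℕ
    reaction = if b then react (G (history s)) (phase s) (nextNat s) else (phase s , nextNat s)

  listen-nextNat-mono : ∀ b s → nextNat s ≤ℕ nextNat (listen b s)
  listen-nextNat-mono false s = ℕ.≤-refl
  listen-nextNat-mono true s = react-nextNat-mono (G (history s)) (phase s) (nextNat s)

  listen-ignores : ∀ s → ¬ Switches s → listen true s ≡ s
  listen-ignores s no-switch =
    cong (λ r → record s { phase = proj₁ r ; nextNat = proj₂ r })
         (react-ignores (G (history s)) (phase s) (nextNat s) no-switch)

  switch-from-negatives : ∀ s → phase s ≡ negatives → Switches s → phase (listen true s) ≡ naturals
  switch-from-negatives ⟨ negatives , a , q , c , h ⟩ refl switch with G h
  ... | -[1+ _ ] = refl

  switch-from-naturals : ∀ s → phase s ≡ naturals → Switches s → Σ ℕ λ n →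
    G (history s) ≡ + n × phase (listen true s) ≡ negatives × n <ℕ nextNat (listen true s)
  switch-from-naturals ⟨ naturals , a , q , c , h ⟩ refl switch with G h
  ... | + n = n , refl , refl , ℕ.m≤n⊔m q (suc n)

  initial : State
  initial = ⟨ negatives , 1 , suc i , -[1+ 0 ] , -[1+ 0 ] ∷ [] ⟩

  run : (ℕ → Bool) → ℕ → State
  run policy zero = initial
  run policy (suc t) = emit (listen (policy t) (run policy t))

  module Run (policy : ℕ → Bool) where

    state : ℕ → State
    state = run policy

    decided : ℕ → State
    decided t = listen (policy t) (state t)

    x : ℕ → ℤ
    x t = current (state t)

    prefix≡history : ∀ t → prefix x t ≡ history (state t)
    prefix≡history zero = refl
    prefix≡history (suc t) = begin
      map x (upTo (suc (suc t)))               ≡⟨ cong (map x) (sym (upTo-∷ʳ (suc t))) ⟩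
      map x (upTo (suc t) ∷ʳ suc t)            ≡⟨ map-++ x (upTo (suc t)) (suc t ∷ []) ⟩
      prefix x t ∷ʳ x (suc t)                  ≡⟨ cong (_∷ʳ x (suc t)) (prefix≡history t) ⟩
      history (decided t) ∷ʳ x (suc t)         ≡⟨ sym (emit-history (decided t)) ⟩
      history (state (suc t))                  ∎
      where open ≡-Reasoning

    side-x : ∀ t → side (x t) ≡ phase (state t)
    side-x zero = refl
    side-x (suc t) = side-current-emit (decided t)

    nextNeg-mono : ∀ {k l} → k ≤ℕ l → nextNeg (state k) ≤ℕ nextNeg (state l)
    nextNeg-mono = monotone-by-steps (nextNeg ∘ state) (emit-nextNeg-mono ∘ decided)

    decided-nextNat-mono : ∀ {k l} → k ≤ℕ l → nextNat (decided k) ≤ℕ nextNat (decided l)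
    decided-nextNat-mono = monotone-by-steps (nextNat ∘ decided) λ k →
      ℕ.≤-trans (emit-nextNat-mono (decided k)) (listen-nextNat-mono (policy (suc k)) (state (suc k)))

    x-negative : ∀ k {m} → x k ≡ -[1+ m ] → nextNeg (state k) ≡ suc m
    x-negative zero refl = refl
    x-negative (suc k) e = proj₂ (emit-negative (decided k) e)

    x-natural : ∀ k {p} → x k ≡ + p → nextNat (state k) ≡ suc p
    x-natural zero ()
    x-natural (suc k) e = proj₂ (emit-natural (decided k) e)

    emitted-again : ∀ {k l} v → k ≤ℕ l → x k ≡ v → x (suc l) ≢ v
    emitted-again {k} {l} -[1+ m ] k≤l xk xl = ℕ.1+n≰n (begin
      suc m                ≡⟨ sym (x-negative k xk) ⟩
      nextNeg (state k)    ≤⟨ nextNeg-mono k≤l ⟩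
      nextNeg (state l)    ≡⟨ proj₁ (emit-negative (decided l) xl) ⟩
      m                    ∎)
      where open ℕ.≤-Reasoning
    emitted-again {k} {l} (+ p) k≤l xk xl = ℕ.1+n≰n (begin
      suc p                ≡⟨ sym (x-natural k xk) ⟩
      nextNat (state k)    ≤⟨ listen-nextNat-mono (policy k) (state k) ⟩
      nextNat (decided k)  ≤⟨ decided-nextNat-mono k≤l ⟩
      nextNat (decided l)  ≡⟨ proj₁ (emit-natural (decided l) xl) ⟩
      p                    ∎)
      where open ℕ.≤-Reasoning

    injective : Injective _≡_ _≡_ x
    injective = fresh⇒injective x λ k≤l → emitted-again _ k≤l refl

    naturals-emitted-exceed-i : ∀ k {p} → x k ≡ + p → i <ℕ p
    naturals-emitted-exceed-i zero ()
    naturals-emitted-exceed-i (suc k) e = begin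
      suc i                ≤⟨ listen-nextNat-mono (policy 0) initial ⟩
      nextNat (decided 0)  ≤⟨ decided-nextNat-mono z≤n ⟩
      nextNat (decided k)  ≡⟨ proj₁ (emit-natural (decided k) e) ⟩
      _                    ∎
      where open ℕ.≤-Reasoning

    avoids-interval : ∀ k → ¬ Interval i (x k)
    avoids-interval k I with x k in e | I
    ... | + p | _ , +≤+ p≤i = ℕ.<⇒≱ (naturals-emitted-exceed-i k e) p≤i
    ... | -[1+ _ ] | () , _

    negatives-emitted : ∀ t {m} → m <ℕ nextNeg (state t) → Range x -[1+ m ]
    negatives-emitted zero {zero} _ = 0 , refl
    negatives-emitted zero {suc m} (s≤s ())
    negatives-emitted (suc t) {m} m< with emit-nextNeg-cases (decided t)
    ... | inj₁ same = negatives-emitted t (subst (m <ℕ_) same m<)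
    ... | inj₂ (grown , emitted) with ℕ.m<1+n⇒m<n∨m≡n (subst (m <ℕ_) grown m<)
    ...   | inj₁ m<n = negatives-emitted t m<n
    ...   | inj₂ refl = suc t , emitted

    not-emitted-after : ∀ t {p} → p <ℕ nextNat (decided t) → Range x (+ p) → InS x t (+ p)
    not-emitted-after t p< (zero , ())
    not-emitted-after t p< (suc k , e) with suc k ≤? t
    ... | yes k<t = suc k , k<t , e
    ... | no k≮t = ⊥-elim (ℕ.<⇒≱ p<
      (subst (nextNat (decided t) ≤ℕ_) (proj₁ (emit-natural (decided k) e))
             (decided-nextNat-mono {t} {k} (ℕ.≤-pred (ℕ.≰⇒> k≮t)))))

  listenAlways : ℕ → Bool
  listenAlways _ = true

  listenBefore : ℕ → ℕ → Bool
  listenBefore s t = does (t <? s)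

  adaptive : ℕ → State
  adaptive = run listenAlways

  frozen : ℕ → ℕ → State
  frozen s = run (listenBefore s)

  adaptive≡frozen : ∀ {s t} → t ≤ℕ s → adaptive t ≡ frozen s t
  adaptive≡frozen {s} {zero} _ = refl
  adaptive≡frozen {s} {suc t} t<s rewrite dec-true (t <? s) t<s =
    cong (emit ∘ listen true) (adaptive≡frozen (ℕ.≤-trans (ℕ.n≤1+n t) t<s))

  frozen-step : ∀ {s t} → s ≤ℕ t → frozen s (suc t) ≡ emit (frozen s t)
  frozen-step {s} {t} s≤t rewrite dec-false (t <? s) (ℕ.≤⇒≯ s≤t) = refl

  frozen-phase : ∀ {s t} → s ≤ℕ t → phase (frozen s t) ≡ phase (frozen s s)
  frozen-phase {s} s≤t = go (ℕ.≤⇒≤′ s≤t)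
    where
    go : ∀ {t} → s ≤′ t → phase (frozen s t) ≡ phase (frozen s s)
    go ≤′-refl = refl
    go (≤′-step s≤′t) =
      trans (cong phase (frozen-step (ℕ.≤′⇒≤ s≤′t))) (trans (emit-phase _) (go s≤′t))

  phase-kept-while-frozen : ∀ {s t} → adaptive t ≡ frozen s t → s ≤ℕ t →
    phase (adaptive t) ≡ phase (adaptive s)
  phase-kept-while-frozen {s} same s≤t =
    trans (cong phase same) (trans (frozen-phase s≤t) (cong phase (sym (adaptive≡frozen {s} ℕ.≤-refl))))

  switches-or-stays-frozen : ∀ s d →
    (Σ ℕ λ t → s ≤ℕ t × Switches (adaptive t) × phase (adaptive t) ≡ phase (adaptive s)) ⊎
    adaptive (d + s) ≡ frozen s (d + s)
  switches-or-stays-frozen s zero = inj₂ (adaptive≡frozen {s} ℕ.≤-refl)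
  switches-or-stays-frozen s (suc d) with switches-or-stays-frozen s d
  ... | inj₁ switch = inj₁ switch
  ... | inj₂ same with Switches? (adaptive (d + s))
  ...   | yes switch = inj₁ (d + s , ℕ.m≤n+m s d , switch , phase-kept-while-frozen same (ℕ.m≤n+m s d))
  ...   | no no-switch = inj₂ (begin
    emit (listen true (adaptive (d + s)))  ≡⟨ cong emit (listen-ignores _ no-switch) ⟩
    emit (adaptive (d + s))                ≡⟨ cong emit same ⟩
    emit (frozen s (d + s))                ≡⟨ sym (frozen-step (ℕ.m≤n+m s d)) ⟩
    frozen s (suc d + s)                   ∎)
    where open ≡-Reasoning

  module Frozen (s : ℕ) where
    open Run (listenBefore s) public

    beyond-prefix : ∀ {z} → Range x z → InS x s z ⊎ side z ≡ phase (state s)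
    beyond-prefix (k , refl) with k ≤? s
    ... | yes k≤s = inj₁ (k , k≤s , refl)
    ... | no k≰s = inj₂ (trans (side-x k) (frozen-phase (ℕ.<⇒≤ (ℕ.≰⇒> k≰s))))

    all-negatives-emitted : phase (state s) ≡ negatives → ∀ m → Range x -[1+ m ]
    all-negatives-emitted in-negatives m =
      negatives-emitted (suc m + s) (subst (m <ℕ_) (sym (grows (suc m))) (ℕ.m≤m+n (suc m) _))
      where
      grows : ∀ d → nextNeg (state (d + s)) ≡ d + nextNeg (state s)
      grows zero = refl
      grows (suc d) = begin
        nextNeg (state (suc d + s))        ≡⟨ cong nextNeg (frozen-step (ℕ.m≤n+m s d)) ⟩
        nextNeg (emit (state (d + s)))     ≡⟨ emit-in-negatives _ (trans (frozen-phase (ℕ.m≤n+m s d)) in-negatives) ⟩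
        suc (nextNeg (state (d + s)))      ≡⟨ cong suc (grows d) ⟩
        suc d + nextNeg (state s)          ∎
        where open ≡-Reasoning

    all-naturals-emitted-from : phase (state s) ≡ naturals → ∀ n → nextNat (state s) ≤ℕ n → Range x (+ n)
    all-naturals-emitted-from in-naturals n j≤n =
      suc (n ∸ j + s) , trans (emits-counter (n ∸ j)) (cong +_ (ℕ.m∸n+n≡m j≤n))
      where
      j : ℕ
      j = nextNat (state s)
      emit-at : ∀ d → current (emit (state (d + s))) ≡ + nextNat (state (d + s)) ×
                      nextNat (emit (state (d + s))) ≡ suc (nextNat (state (d + s)))
      emit-at d = emit-in-naturals (state (d + s)) (trans (frozen-phase (ℕ.m≤n+m s d)) in-naturals)
      counter : ∀ d → nextNat (state (d + s)) ≡ d + j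
      counter zero = refl
      counter (suc d) = trans (cong nextNat (frozen-step (ℕ.m≤n+m s d)))
                              (trans (proj₂ (emit-at d)) (cong suc (counter d)))
      emits-counter : ∀ d → x (suc d + s) ≡ + (d + j)
      emits-counter d = trans (cong current (frozen-step (ℕ.m≤n+m s d)))
                              (trans (proj₁ (emit-at d)) (cong +_ (counter d)))

  module Refutation (generates : GeneratesInLimit (suc i) (C i) G) where

    frozen-guesses-side : ∀ s p → phase (frozen s s) ≡ p →
      Σ ℕ λ d → side (G (prefix (Frozen.x s) (d + s))) ≡ p
    frozen-guesses-side s negatives in-negatives =
      eventually-guesses-in {G = G} (λ z → side z ≡ negatives) generates (range∪Neg∈C avoids-interval)
        (enumerates-range∪Neg injective (all-negatives-emitted in-negatives)) s contained
      where
      open Frozen s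
      contained : ∀ z → Range x z ⊎ Neg z → InS x s z ⊎ side z ≡ negatives
      contained z (inj₁ r) = map₂ (λ e → trans e in-negatives) (beyond-prefix r)
      contained -[1+ _ ] (inj₂ _) = inj₂ refl
      contained (+ _) (inj₂ (+<+ ()))
    frozen-guesses-side s naturals in-naturals =
      eventually-guesses-in {G = G} (λ z → side z ≡ naturals) generates Interval∪range∪P∈C
        (enumerates-Interval∪range∪P injective (all-naturals-emitted-from in-naturals)) s contained
      where
      open Frozen s
      contained : ∀ z → Interval i z ⊎ Range x z ⊎ P (+ nextNat (state s)) z → InS x s z ⊎ side z ≡ naturals
      contained (+ _) (inj₁ _) = inj₂ refl
      contained -[1+ _ ] (inj₁ (() , _))
      contained z (inj₂ (inj₁ r)) = map₂ (λ e → trans e in-naturals) (beyond-prefix r)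
      contained (+ _) (inj₂ (inj₂ _)) = inj₂ refl
      contained -[1+ _ ] (inj₂ (inj₂ ()))

    frozen-eventually-switches : ∀ s → Σ ℕ λ d → Switches (frozen s (d + s))
    frozen-eventually-switches s with frozen-guesses-side s (phase (frozen s s)) refl
    ... | d , on-side = d , (begin
      side (G (history (state (d + s))))  ≡⟨ cong (side ∘ G) (sym (prefix≡history (d + s))) ⟩
      side (G (prefix x (d + s)))         ≡⟨ on-side ⟩
      phase (state s)                     ≡⟨ sym (frozen-phase (ℕ.m≤n+m s d)) ⟩
      phase (state (d + s))               ∎)
      where
      open Frozen s
      open ≡-Reasoning

    phase-ends : ∀ s → Σ ℕ λ t → s ≤ℕ t × Switches (adaptive t) × phase (adaptive t) ≡ phase (adaptive s)
    phase-ends s with frozen-eventually-switches s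
    ... | d , switch with switches-or-stays-frozen s d
    ...   | inj₁ ended = ended
    ...   | inj₂ same = d + s , ℕ.m≤n+m s d , subst Switches (sym same) switch ,
                        phase-kept-while-frozen same (ℕ.m≤n+m s d)

    open Run listenAlways public

    negatives-recur : ∀ s → Σ ℕ λ t → s <ℕ t × phase (adaptive t) ≡ negatives
    negatives-recur s with phase (adaptive (suc s)) in e
    ... | negatives = suc s , ℕ.≤-refl , e
    ... | naturals with phase-ends (suc s)
    ...   | t , s<t , switch , in-naturals
      with switch-from-naturals (adaptive t) (trans in-naturals e) switch
    ...     | _ , _ , to-negatives , _ = suc t , ℕ.m≤n⇒m≤1+n s<t , trans (emit-phase _) to-negatives

    nextNeg-unbounded : ∀ m → Σ ℕ λ t → m <ℕ nextNeg (adaptive t)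
    nextNeg-unbounded zero = 0 , s≤s z≤n
    nextNeg-unbounded (suc m) with nextNeg-unbounded m
    ... | t , m< with negatives-recur t
    ...   | suc t′ , s≤s t≤t′ , in-negatives = suc t′ , (begin-strict
      suc m                      ≤⟨ m< ⟩
      nextNeg (adaptive t)       ≤⟨ nextNeg-mono t≤t′ ⟩
      nextNeg (adaptive t′)      <⟨ ℕ.n<1+n _ ⟩
      suc (nextNeg (decided t′)) ≡⟨ sym (emit-in-negatives (decided t′) (trans (sym (emit-phase _)) in-negatives)) ⟩
      nextNeg (adaptive (suc t′)) ∎)
      where open ℕ.≤-Reasoning

    all-negatives-emitted : ∀ m → Range x -[1+ m ]
    all-negatives-emitted m with nextNeg-unbounded m
    ... | t , m< = negatives-emitted t m<

    naturals-switch-after : ∀ s → Σ ℕ λ t → s ≤ℕ t × Switches (adaptive t) × phase (adaptive t) ≡ naturals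
    naturals-switch-after s with phase-ends s
    ... | t₁ , s≤t₁ , switch₁ , _ with phase (adaptive t₁) in e
    ...   | naturals = t₁ , s≤t₁ , trans switch₁ (sym e) , e
    ...   | negatives with phase-ends (suc t₁)
    ...     | t₂ , t₁<t₂ , switch₂ , same =
      t₂ , ℕ.≤-trans s≤t₁ (ℕ.≤-trans (ℕ.n≤1+n t₁) t₁<t₂) , switch₂ ,
      trans same (trans (emit-phase _) (switch-from-negatives (adaptive t₁) e (trans switch₁ (sym e))))

    stale-guess-after : ∀ s → Σ ℕ λ t → s ≤ℕ t ×
      (Range x (G (prefix x t)) ⊎ Neg (G (prefix x t)) → InS x t (G (prefix x t)))
    stale-guess-after s with naturals-switch-after s
    ... | t , s≤t , switch , in-naturals with switch-from-naturals (adaptive t) in-naturals switch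
    ...   | n , guessed , _ , n<next = t , s≤t , λ valid →
      subst (InS x t) (sym guess≡n) (stale (subst (λ g → Range x g ⊎ Neg g) guess≡n valid))
      where
      guess≡n : G (prefix x t) ≡ + n
      guess≡n = trans (cong G (prefix≡history t)) guessed
      stale : Range x (+ n) ⊎ Neg (+ n) → InS x t (+ n)
      stale (inj₁ emitted) = not-emitted-after t n<next emitted
      stale (inj₂ (+<+ ()))

lemma4p9 : (i : ℕ) → (G : Generator) → ¬ GeneratesInLimit (suc i) (C i) G
lemma4p9 i G generates =
  let open Adversary i G
      open Refutation generates
      (t⋆ , success) = generates _ (range∪Neg∈C avoids-interval) x
                                   (enumerates-range∪Neg injective all-negatives-emitted)
      (t , t⋆≤t , stale) = stale-guess-after t⋆
      (valid , new) = success t t⋆≤t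
  in new (stale valid)
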